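{- Let $k\ge1$, $l_1,\dots,l_k\ge 1$, and let $G=C_m(l_1,\dots,l_k)$ be a unicyclic graph of order $n$. Then $HM(G)\le HM(C_m(n-m))$, with equality if and only if $k=1$.
   Context: A unicyclic graph is a connected graph with exactly one cycle. $C_m(l_1,\dots,l_k)$ denotes the graph obtained from the cycle $C_m$ by choosing $k$ distinct cycle vertices $u_1,\dots,u_k$ and attaching $l_i$ pendant vertices to $u_i$; its order is $n=m+\sum_i l_i$. $C_m(n-m)$ is the cycle $C_m$ with $n-m$ pendant vertices attached to a single cycle vertex. $HM(G)=\sum_{xy\in E(G)}(d_G(x)+d_G(y))^2$, $d_G$ the vertex degree. -}

module Defs where

open import Data.Nat using (ℕ; zero; suc; _+_; _*_; _∸_; _^_; _≡ᵇ_)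
open import Data.Bool using (if_then_else_)
open import Data.Fin using (Fin; toℕ)
open import Data.Product using (_×_; _,_)
open import Data.List using (List; []; _∷_; _++_; map; upTo; tabulate)
open import Data.Nat.ListAction using (sum)

-- A (multi)graph given by its edge list; vertices are natural-number labels.
Edge : Set
Edge = ℕ × ℕ

deg : List Edge → ℕ → ℕ
deg E v = sum (map (λ { (a , b) → (if a ≡ᵇ v then 1 else 0) + (if b ≡ᵇ v then 1 else 0) }) E)

HM : List Edge → ℕ
HM E = sum (map (λ { (a , b) → (deg E a + deg E b) ^ 2 }) E)

cycleEdges : ℕ → List Edge
cycleEdges m = map (λ i → (i , suc i)) (upTo (m ∸ 1)) ++ ((m ∸ 1 , 0) ∷ [])

pendantEdges : ℕ → List (ℕ × ℕ) → List Edge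
pendantEdges s [] = []
pendantEdges s ((u , l) ∷ rest) = map (λ j → (u , s + j)) (upTo l) ++ pendantEdges (s + l) rest

Cml : (m k : ℕ) → (Fin k → Fin m) → (Fin k → ℕ) → List Edge
Cml m k u l = cycleEdges m ++ pendantEdges m (tabulate (λ i → (toℕ (u i) , l i)))

order : (m k : ℕ) → (Fin k → ℕ) → ℕ
order m k l = m + sum (tabulate l)

Cm1 : (m p : ℕ) → List Edge
Cm1 m p = cycleEdges m ++ pendantEdges m ((0 , p) ∷ [])

module Submission where

-- Write L v for the number of pendant vertices attached to the cycle vertex v, and
-- S = Σ L v = n − m. Cycle vertices have degree 2 + L v and pendant vertices degree 1, so
--   HM(G) = 16m + 16S + Σ_{uv ∈ C_m} (L u + L v)² + Σ_i l_i (l_i + 3)².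
-- The loads L u + L v of the cycle edges add up to 2S and, since every edge joins two
-- distinct vertices, each of them is at most S; hence the cycle term is at most 2S², with
-- equality when all pendants hang at one vertex. The pendant term is at most S (S + 3)²
-- because p ↦ p (p + 3)² is superadditive, strictly so on positive arguments, which rules
-- out equality for k ≥ 2.

open import Defs
open import Data.Nat using (ℕ; zero; suc; _+_; _*_; _∸_; _^_; _≤_; _<_; _≡ᵇ_; z≤n; s≤s; z<s)
open import Data.Nat.Properties
open import Data.Bool using (true; false; if_then_else_)
open import Data.Unit using (tt)
open import Data.Fin using (Fin; toℕ) renaming (zero to fzero; suc to fsuc)
open import Data.Fin.Properties using (toℕ<n; toℕ-injective) renaming (0≢1+n to fzero≢fsuc; suc-injective to fsuc-injective)
open import Data.Empty using (⊥-elim)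
open import Data.Product using (_×_; _,_; proj₁; proj₂; ∃)
open import Data.Sum using (_⊎_; inj₁; inj₂)
open import Data.List using (List; []; _∷_; _++_; map; upTo; length; tabulate)
open import Data.List.Properties using (map-++; map-∘; map-cong; map-applyUpTo; map-upTo; upTo-∷ʳ; length-upTo; length-++; length-map; map-tabulate; tabulate-cong)
open import Data.List.Membership.Propositional using (_∈_)
open import Data.List.Membership.Propositional.Properties using (∈-++⁻; ∈-map⁻; ∈-upTo⁻; ∈-tabulate⁻)
open import Data.List.Relation.Unary.Any using (here; there)
open import Data.Nat.ListAction using (sum)
open import Data.Nat.ListAction.Properties using (sum-++)
open import Relation.Binary.PropositionalEquality
open import Relation.Nullary using (yes; no)
open import Function using (_∘_)
open import Function.Definitions using (Injective)
open import Function.Bundles using (_⇔_; mk⇔)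
open import Data.Nat.Tactic.RingSolver using (solve-∀; solve)
open import Algebra.Properties.CommutativeSemigroup +-commutativeSemigroup using () renaming (interchange to +-interchange)

δ : ℕ → ℕ → ℕ
δ a v = if a ≡ᵇ v then 1 else 0

δ-refl : ∀ a → δ a a ≡ 1
δ-refl a with a ≡ᵇ a | ≡⇒≡ᵇ a a refl
... | true | _ = refl

δ-≢ : ∀ {a v} → a ≢ v → δ a v ≡ 0
δ-≢ {a} {v} a≢v with a ≡ᵇ v | ≡ᵇ⇒≡ a v
... | false | _ = refl
... | true | eq = ⊥-elim (a≢v (eq tt))

δ-comm : ∀ a v → δ a v ≡ δ v a
δ-comm zero zero = refl
δ-comm zero (suc v) = refl
δ-comm (suc a) zero = refl
δ-comm (suc a) (suc v) = δ-comm a v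

δ-shift : ∀ s a v → δ (s + a) (s + v) ≡ δ a v
δ-shift zero a v = refl
δ-shift (suc s) a v = δ-shift s a v

δ≤1 : ∀ a v → δ a v ≤ 1
δ≤1 a v with a ≡ᵇ v
... | true = ≤-refl
... | false = z≤n

δ+δ≤1 : ∀ u {a b} → a ≢ b → δ u a + δ u b ≤ 1
δ+δ≤1 u {a} {b} a≢b with u ≟ a
... | yes refl rewrite δ-refl u | δ-≢ a≢b = ≤-refl
... | no u≢a rewrite δ-≢ u≢a = δ≤1 u b

-- Sums over lists

∑ : {A : Set} → (A → ℕ) → List A → ℕ
∑ f xs = sum (map f xs)

module _ {A : Set} where

  ∑-++ : ∀ (f : A → ℕ) xs ys → ∑ f (xs ++ ys) ≡ ∑ f xs + ∑ f ys
  ∑-++ f xs ys = trans (cong sum (map-++ f xs ys)) (sum-++ (map f xs) (map f ys))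

  ∑-map : ∀ {B : Set} (f : B → ℕ) (g : A → B) xs → ∑ f (map g xs) ≡ ∑ (f ∘ g) xs
  ∑-map f g xs = cong sum (sym (map-∘ xs))

  ∑-+ : ∀ (f g : A → ℕ) xs → ∑ (λ x → f x + g x) xs ≡ ∑ f xs + ∑ g xs
  ∑-+ f g [] = refl
  ∑-+ f g (x ∷ xs) = trans (cong (f x + g x +_) (∑-+ f g xs)) (+-interchange (f x) (g x) _ _)

  ∑-*ˡ : ∀ c (f : A → ℕ) xs → ∑ (λ x → c * f x) xs ≡ c * ∑ f xs
  ∑-*ˡ c f [] = sym (*-zeroʳ c)
  ∑-*ˡ c f (x ∷ xs) = trans (cong (c * f x +_) (∑-*ˡ c f xs)) (sym (*-distribˡ-+ c (f x) _))

  ∑-const : ∀ c (xs : List A) → ∑ (λ _ → c) xs ≡ length xs * c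
  ∑-const c [] = refl
  ∑-const c (x ∷ xs) = cong (c +_) (∑-const c xs)

  ∑-cong : ∀ {f g : A → ℕ} xs → (∀ {x} → x ∈ xs → f x ≡ g x) → ∑ f xs ≡ ∑ g xs
  ∑-cong [] eq = refl
  ∑-cong (x ∷ xs) eq = cong₂ _+_ (eq (here refl)) (∑-cong xs (eq ∘ there))

  ∑-zero : ∀ {f : A → ℕ} xs → (∀ {x} → x ∈ xs → f x ≡ 0) → ∑ f xs ≡ 0
  ∑-zero xs eq = trans (∑-cong xs eq) (trans (∑-const 0 xs) (*-zeroʳ (length xs)))

  ∑-mono-≤ : ∀ {f g : A → ℕ} xs → (∀ {x} → x ∈ xs → f x ≤ g x) → ∑ f xs ≤ ∑ g xs
  ∑-mono-≤ [] le = z≤n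
  ∑-mono-≤ (x ∷ xs) le = +-mono-≤ (le (here refl)) (∑-mono-≤ xs (le ∘ there))

∑-const-upTo : ∀ c n → ∑ (λ _ → c) (upTo n) ≡ n * c
∑-const-upTo c n = trans (∑-const c (upTo n)) (cong (_* c) (length-upTo n))

∑-upTo-suc : ∀ f n → ∑ f (upTo (suc n)) ≡ f 0 + ∑ (f ∘ suc) (upTo n)
∑-upTo-suc f n = cong (λ xs → f 0 + sum xs) (trans (map-applyUpTo suc f n) (sym (map-upTo (f ∘ suc) n)))

∑-upTo-+ : ∀ f m n → ∑ f (upTo (m + n)) ≡ ∑ f (upTo m) + ∑ (λ i → f (m + i)) (upTo n)
∑-upTo-+ f zero n = refl
∑-upTo-+ f (suc m) n = begin
  ∑ f (upTo (suc (m + n)))                                 ≡⟨ ∑-upTo-suc f (m + n) ⟩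
  f 0 + ∑ (f ∘ suc) (upTo (m + n))                         ≡⟨ cong (f 0 +_) (∑-upTo-+ (f ∘ suc) m n) ⟩
  f 0 + (∑ (f ∘ suc) (upTo m) + ∑ (λ i → f (suc m + i)) (upTo n))
    ≡⟨ sym (+-assoc (f 0) _ _) ⟩
  f 0 + ∑ (f ∘ suc) (upTo m) + ∑ (λ i → f (suc m + i)) (upTo n)
    ≡⟨ cong (_+ ∑ (λ i → f (suc m + i)) (upTo n)) (sym (∑-upTo-suc f m)) ⟩
  ∑ f (upTo (suc m)) + ∑ (λ i → f (suc m + i)) (upTo n)   ∎
  where open ≡-Reasoning

∑-δ-upTo-< : ∀ {n v} → v < n → ∑ (λ i → δ i v) (upTo n) ≡ 1
∑-δ-upTo-< {suc n} {zero} _ =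
  trans (∑-upTo-suc (λ i → δ i 0) n) (cong suc (∑-zero (upTo n) (λ _ → refl)))
∑-δ-upTo-< {suc n} {suc v} (s≤s v<n) =
  trans (∑-upTo-suc (λ i → δ i (suc v)) n) (∑-δ-upTo-< v<n)

∑-δ-upTo-≥ : ∀ {n v} → n ≤ v → ∑ (λ i → δ i v) (upTo n) ≡ 0
∑-δ-upTo-≥ {zero} _ = refl
∑-δ-upTo-≥ {suc n} {suc v} (s≤s n≤v) =
  trans (∑-upTo-suc (λ i → δ i (suc v)) n) (∑-δ-upTo-≥ n≤v)

-- Degrees in C_m(l₁,…,l_k)

incident : ℕ → Edge → ℕ
incident v (a , b) = δ a v + δ b v

deg-∑ : ∀ E v → deg E v ≡ ∑ (incident v) E
deg-∑ [] v = refl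
deg-∑ ((a , b) ∷ E) v = cong (δ a v + δ b v +_) (deg-∑ E v)

deg-++ : ∀ E F v → deg (E ++ F) v ≡ deg E v + deg F v
deg-++ E F v = begin
  deg (E ++ F) v                       ≡⟨ deg-∑ (E ++ F) v ⟩
  ∑ (incident v) (E ++ F)              ≡⟨ ∑-++ (incident v) E F ⟩
  ∑ (incident v) E + ∑ (incident v) F  ≡⟨ sym (cong₂ _+_ (deg-∑ E v) (deg-∑ F v)) ⟩
  deg E v + deg F v                    ∎
  where open ≡-Reasoning

edgeWeight : (ℕ → ℕ) → Edge → ℕ
edgeWeight D (a , b) = (D a + D b) ^ 2

HM-∑ : ∀ E → HM E ≡ ∑ (edgeWeight (deg E)) E
HM-∑ E = cong sum (map-cong (λ { (a , b) → refl }) E)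

deg-cycleEdges : ∀ n v →
  deg (cycleEdges (suc n)) v ≡ ∑ (λ i → δ i v) (upTo (suc n)) + ∑ (λ i → δ i v) (upTo (suc n))
deg-cycleEdges n v = begin
  deg (cycleEdges (suc n)) v
    ≡⟨ deg-∑ (cycleEdges (suc n)) v ⟩
  ∑ (incident v) (map (λ i → (i , suc i)) (upTo n) ++ (n , 0) ∷ [])
    ≡⟨ ∑-++ (incident v) (map (λ i → (i , suc i)) (upTo n)) _ ⟩
  ∑ (incident v) (map (λ i → (i , suc i)) (upTo n)) + (δ n v + δ 0 v + 0)
    ≡⟨ cong (_+ (δ n v + δ 0 v + 0)) (∑-map (incident v) (λ i → (i , suc i)) (upTo n)) ⟩
  ∑ (λ i → δ i v + δ (suc i) v) (upTo n) + (δ n v + δ 0 v + 0)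
    ≡⟨ cong (_+ (δ n v + δ 0 v + 0)) (∑-+ (λ i → δ i v) (λ i → δ (suc i) v) (upTo n)) ⟩
  ∑ (λ i → δ i v) (upTo n) + ∑ (λ i → δ (suc i) v) (upTo n) + (δ n v + δ 0 v + 0)
    ≡⟨ regroup (∑ (λ i → δ i v) (upTo n)) (∑ (λ i → δ (suc i) v) (upTo n)) (δ n v) (δ 0 v) ⟩
  (∑ (λ i → δ i v) (upTo n) + (δ n v + 0)) + (δ 0 v + ∑ (λ i → δ (suc i) v) (upTo n))
    ≡⟨ cong₂ _+_ (sym (∑-++ (λ i → δ i v) (upTo n) (n ∷ [])))
                  (sym (∑-upTo-suc (λ i → δ i v) n)) ⟩
  ∑ (λ i → δ i v) (upTo n ++ n ∷ []) + ∑ (λ i → δ i v) (upTo (suc n))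
    ≡⟨ cong (λ xs → ∑ (λ i → δ i v) xs + ∑ (λ i → δ i v) (upTo (suc n))) (upTo-∷ʳ n) ⟩
  ∑ (λ i → δ i v) (upTo (suc n)) + ∑ (λ i → δ i v) (upTo (suc n))  ∎
  where
  open ≡-Reasoning
  regroup : ∀ x y z w → x + y + (z + w + 0) ≡ (x + (z + 0)) + (w + y)
  regroup = solve-∀

deg-cycleEdges-< : ∀ {n v} → v < suc n → deg (cycleEdges (suc n)) v ≡ 2
deg-cycleEdges-< {n} {v} v<m rewrite deg-cycleEdges n v | ∑-δ-upTo-< v<m = refl

deg-cycleEdges-≥ : ∀ {n v} → suc n ≤ v → deg (cycleEdges (suc n)) v ≡ 0
deg-cycleEdges-≥ {n} {v} m≤v rewrite deg-cycleEdges n v | ∑-δ-upTo-≥ m≤v = refl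

length-cycleEdges : ∀ n → length (cycleEdges (suc n)) ≡ suc n
length-cycleEdges n = begin
  length (map (λ i → (i , suc i)) (upTo n) ++ (n , 0) ∷ [])  ≡⟨ length-++ (map (λ i → (i , suc i)) (upTo n)) ⟩
  length (map (λ i → (i , suc i)) (upTo n)) + 1             ≡⟨ cong (_+ 1) (length-map _ (upTo n)) ⟩
  length (upTo n) + 1                                        ≡⟨ cong (_+ 1) (length-upTo n) ⟩
  n + 1                                                      ≡⟨ +-comm n 1 ⟩
  suc n                                                      ∎
  where open ≡-Reasoning

∈-cycleEdges⁻ : ∀ {n e} → e ∈ cycleEdges (suc n) →
  (∃ λ i → i < n × e ≡ (i , suc i)) ⊎ e ≡ (n , 0)
∈-cycleEdges⁻ {n} e∈ with ∈-++⁻ (map (λ i → (i , suc i)) (upTo n)) e∈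
... | inj₁ e∈path with i , i∈ , refl ← ∈-map⁻ (λ i → (i , suc i)) e∈path = inj₁ (i , ∈-upTo⁻ i∈ , refl)
... | inj₂ (here refl) = inj₂ refl

cycleEdge-endpoints : ∀ {n a b} → (a , b) ∈ cycleEdges (suc n) → a < suc n × b < suc n
cycleEdge-endpoints e∈ with ∈-cycleEdges⁻ e∈
... | inj₁ (i , i<n , refl) = m<n⇒m<1+n i<n , s≤s i<n
... | inj₂ refl = ≤-refl , s≤s z≤n

cycleEdge-loopless : ∀ {n a b} → (a , b) ∈ cycleEdges (2 + n) → a ≢ b
cycleEdge-loopless {n} e∈ with ∈-cycleEdges⁻ {suc n} e∈
... | inj₁ (i , _ , refl) = <⇒≢ (n<1+n i)
... | inj₂ refl = λ ()

load : List (ℕ × ℕ) → ℕ → ℕ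
load PL v = ∑ (λ (u , l) → l * δ u v) PL

total : List (ℕ × ℕ) → ℕ
total = ∑ proj₂

deg-pendantBlock : ∀ u s l v →
  deg (map (λ j → (u , s + j)) (upTo l)) v ≡ l * δ u v + ∑ (λ j → δ (s + j) v) (upTo l)
deg-pendantBlock u s l v = begin
  deg (map (λ j → (u , s + j)) (upTo l)) v
    ≡⟨ deg-∑ (map (λ j → (u , s + j)) (upTo l)) v ⟩
  ∑ (incident v) (map (λ j → (u , s + j)) (upTo l))
    ≡⟨ ∑-map (incident v) (λ j → (u , s + j)) (upTo l) ⟩
  ∑ (λ j → δ u v + δ (s + j) v) (upTo l)
    ≡⟨ ∑-+ (λ _ → δ u v) (λ j → δ (s + j) v) (upTo l) ⟩
  ∑ (λ _ → δ u v) (upTo l) + ∑ (λ j → δ (s + j) v) (upTo l)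
    ≡⟨ cong (_+ ∑ (λ j → δ (s + j) v) (upTo l)) (∑-const-upTo (δ u v) l) ⟩
  l * δ u v + ∑ (λ j → δ (s + j) v) (upTo l)  ∎
  where open ≡-Reasoning

deg-pendantEdges : ∀ s PL v →
  deg (pendantEdges s PL) v ≡ load PL v + ∑ (λ t → δ (s + t) v) (upTo (total PL))
deg-pendantEdges s [] v = refl
deg-pendantEdges s ((u , l) ∷ r) v = begin
  deg (map (λ j → (u , s + j)) (upTo l) ++ pendantEdges (s + l) r) v
    ≡⟨ deg-++ (map (λ j → (u , s + j)) (upTo l)) _ v ⟩
  deg (map (λ j → (u , s + j)) (upTo l)) v + deg (pendantEdges (s + l) r) v
    ≡⟨ cong₂ _+_ (deg-pendantBlock u s l v) (deg-pendantEdges (s + l) r v) ⟩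
  l * δ u v + ∑ (λ j → δ (s + j) v) (upTo l) + (load r v + ∑ (λ t → δ (s + l + t) v) (upTo (total r)))
    ≡⟨ cong (λ y → l * δ u v + ∑ (λ j → δ (s + j) v) (upTo l) + (load r v + y))
            (∑-cong (upTo (total r)) (λ {t} _ → cong (λ w → δ w v) (+-assoc s l t))) ⟩
  l * δ u v + ∑ (λ j → δ (s + j) v) (upTo l) + (load r v + ∑ (λ t → δ (s + (l + t)) v) (upTo (total r)))
    ≡⟨ +-interchange (l * δ u v) _ (load r v) _ ⟩
  l * δ u v + load r v + (∑ (λ j → δ (s + j) v) (upTo l) + ∑ (λ t → δ (s + (l + t)) v) (upTo (total r)))
    ≡⟨ cong (l * δ u v + load r v +_) (sym (∑-upTo-+ (λ t → δ (s + t) v) l (total r))) ⟩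
  l * δ u v + load r v + ∑ (λ t → δ (s + t) v) (upTo (l + total r))  ∎
  where open ≡-Reasoning

RootsBelow : ℕ → List (ℕ × ℕ) → Set
RootsBelow s PL = ∀ {p} → p ∈ PL → proj₁ p < s

load-absent : ∀ {v} PL → (∀ {p} → p ∈ PL → proj₁ p ≢ v) → load PL v ≡ 0
load-absent PL u≢v = ∑-zero PL (λ {(u , l)} p∈ → trans (cong (l *_) (δ-≢ (u≢v p∈))) (*-zeroʳ l))

deg-pendantEdges-< : ∀ {s v} PL → v < s → deg (pendantEdges s PL) v ≡ load PL v
deg-pendantEdges-< {s} {v} PL v<s = begin
  deg (pendantEdges s PL) v                                 ≡⟨ deg-pendantEdges s PL v ⟩
  load PL v + ∑ (λ t → δ (s + t) v) (upTo (total PL))      ≡⟨ cong (load PL v +_) (∑-zero (upTo (total PL)) fresh) ⟩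
  load PL v + 0                                             ≡⟨ +-identityʳ (load PL v) ⟩
  load PL v                                                 ∎
  where
  open ≡-Reasoning
  fresh : ∀ {t} → t ∈ upTo (total PL) → δ (s + t) v ≡ 0
  fresh {t} _ = δ-≢ (>⇒≢ (<-≤-trans v<s (m≤m+n s t)))

deg-pendantEdges-fresh : ∀ {s t} PL → RootsBelow s PL → t < total PL → deg (pendantEdges s PL) (s + t) ≡ 1
deg-pendantEdges-fresh {s} {t} PL roots t<total = begin
  deg (pendantEdges s PL) (s + t)                                ≡⟨ deg-pendantEdges s PL (s + t) ⟩
  load PL (s + t) + ∑ (λ t′ → δ (s + t′) (s + t)) (upTo (total PL))
    ≡⟨ cong₂ _+_ (load-absent PL (λ p∈ → <⇒≢ (<-≤-trans (roots p∈) (m≤m+n s t))))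
                  (∑-cong (upTo (total PL)) (λ {t′} _ → δ-shift s t′ t)) ⟩
  ∑ (λ t′ → δ t′ t) (upTo (total PL))                           ≡⟨ ∑-δ-upTo-< t<total ⟩
  1                                                              ∎
  where open ≡-Reasoning

-- Both Cml m k u l and Cm1 m p are of this form by definition.
unicyclic : ℕ → List (ℕ × ℕ) → List Edge
unicyclic m PL = cycleEdges m ++ pendantEdges m PL

deg-unicyclic-cycle : ∀ {n v} PL → v < suc n → deg (unicyclic (suc n) PL) v ≡ 2 + load PL v
deg-unicyclic-cycle {n} {v} PL v<m = trans (deg-++ (cycleEdges (suc n)) _ v)
  (cong₂ _+_ (deg-cycleEdges-< v<m) (deg-pendantEdges-< PL v<m))

deg-unicyclic-pendant : ∀ {n t} PL → RootsBelow (suc n) PL → t < total PL →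
  deg (unicyclic (suc n) PL) (suc n + t) ≡ 1
deg-unicyclic-pendant {n} {t} PL roots t<total = trans (deg-++ (cycleEdges (suc n)) _ (suc n + t))
  (cong₂ _+_ (deg-cycleEdges-≥ (m≤m+n (suc n) t)) (deg-pendantEdges-fresh PL roots t<total))

-- The hyper-Zagreb index of C_m(l₁,…,l_k)

∑-pendantEdges : ∀ (g : Edge → ℕ) (h : ℕ → ℕ) s PL →
  (∀ {u t} → t < total PL → g (u , s + t) ≡ h u) →
  ∑ g (pendantEdges s PL) ≡ ∑ (λ (u , l) → l * h u) PL
∑-pendantEdges g h s [] _ = refl
∑-pendantEdges g h s ((u , l) ∷ r) g≡h = begin
  ∑ g (map (λ j → (u , s + j)) (upTo l) ++ pendantEdges (s + l) r)
    ≡⟨ ∑-++ g (map (λ j → (u , s + j)) (upTo l)) _ ⟩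
  ∑ g (map (λ j → (u , s + j)) (upTo l)) + ∑ g (pendantEdges (s + l) r)
    ≡⟨ cong₂ _+_ (∑-map g (λ j → (u , s + j)) (upTo l)) (∑-pendantEdges g h (s + l) r g≡h′) ⟩
  ∑ (λ j → g (u , s + j)) (upTo l) + ∑ (λ (u , l) → l * h u) r
    ≡⟨ cong (_+ ∑ (λ (u , l) → l * h u) r) (∑-cong (upTo l) (λ j∈ → g≡h (≤-trans (∈-upTo⁻ j∈) (m≤m+n l _)))) ⟩
  ∑ (λ _ → h u) (upTo l) + ∑ (λ (u , l) → l * h u) r
    ≡⟨ cong (_+ ∑ (λ (u , l) → l * h u) r) (∑-const-upTo (h u) l) ⟩
  l * h u + ∑ (λ (u , l) → l * h u) r  ∎
  where
  open ≡-Reasoning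
  g≡h′ : ∀ {w t} → t < total r → g (w , s + l + t) ≡ h w
  g≡h′ {w} {t} t< = trans (cong (λ x → g (w , x)) (+-assoc s l t)) (g≡h (+-monoʳ-< l t<))

edgeLoad : (ℕ → ℕ) → Edge → ℕ
edgeLoad L (a , b) = L a + L b

∑-edgeLoad-load : ∀ E PL → ∑ (edgeLoad (load PL)) E ≡ ∑ (λ (u , l) → l * deg E u) PL
∑-edgeLoad-load E [] = ∑-zero E (λ _ → refl)
∑-edgeLoad-load E ((u , l) ∷ r) = begin
  ∑ (edgeLoad (load ((u , l) ∷ r))) E
    ≡⟨ ∑-cong E (λ {e} _ → split e) ⟩
  ∑ (λ e → l * incident u e + edgeLoad (load r) e) E
    ≡⟨ ∑-+ (λ e → l * incident u e) (edgeLoad (load r)) E ⟩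
  ∑ (λ e → l * incident u e) E + ∑ (edgeLoad (load r)) E
    ≡⟨ cong₂ _+_ (trans (∑-*ˡ l (incident u) E) (cong (l *_) (sym (deg-∑ E u)))) (∑-edgeLoad-load E r) ⟩
  l * deg E u + ∑ (λ (u , l) → l * deg E u) r  ∎
  where
  open ≡-Reasoning
  regroup : ∀ x y p q r → x * p + y + (x * q + r) ≡ x * (p + q) + (y + r)
  regroup = solve-∀
  split : ∀ e → edgeLoad (load ((u , l) ∷ r)) e ≡ l * incident u e + edgeLoad (load r) e
  split (a , b) rewrite δ-comm a u | δ-comm b u = regroup l (load r a) (δ u a) (δ u b) (load r b)

∑-edgeLoad-cycleEdges : ∀ {n} PL → RootsBelow (suc n) PL →
  ∑ (edgeLoad (load PL)) (cycleEdges (suc n)) ≡ 2 * total PL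
∑-edgeLoad-cycleEdges {n} PL roots = begin
  ∑ (edgeLoad (load PL)) (cycleEdges (suc n))       ≡⟨ ∑-edgeLoad-load (cycleEdges (suc n)) PL ⟩
  ∑ (λ (u , l) → l * deg (cycleEdges (suc n)) u) PL
    ≡⟨ ∑-cong PL (λ {(u , l)} p∈ → trans (cong (l *_) (deg-cycleEdges-< (roots p∈))) (*-comm l 2)) ⟩
  ∑ (λ (u , l) → 2 * l) PL                          ≡⟨ ∑-*ˡ 2 proj₂ PL ⟩
  2 * total PL                                      ∎
  where open ≡-Reasoning

-- The ring solver does not handle _^_, so from here on squares are written as products.
square : ∀ x → x ^ 2 ≡ x * x
square x = cong (x *_) (*-identityʳ x)

HM-unicyclic : ∀ n PL → RootsBelow (suc n) PL →
  HM (unicyclic (suc n) PL) ≡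
    16 * suc n + 16 * total PL
    + ∑ (λ e → edgeLoad (load PL) e * edgeLoad (load PL) e) (cycleEdges (suc n))
    + ∑ (λ (u , l) → l * ((3 + load PL u) * (3 + load PL u))) PL
HM-unicyclic n PL roots = begin
  HM (C ++ P)    ≡⟨ HM-∑ (C ++ P) ⟩
  ∑ w (C ++ P)   ≡⟨ ∑-++ w C P ⟩
  ∑ w C + ∑ w P  ≡⟨ cong₂ _+_ cycle-part pendant-part ⟩
  16 * suc n + 16 * total PL + ∑ (λ e → x e * x e) C + ∑ (λ (u , l) → l * ((3 + L u) * (3 + L u))) PL  ∎
  where
  open ≡-Reasoning
  C = cycleEdges (suc n)
  P = pendantEdges (suc n) PL
  D = deg (C ++ P)
  w = edgeWeight D
  L = load PL
  x = edgeLoad L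

  expand-cycle : ∀ p q → (2 + p + (2 + q)) ^ 2 ≡ 16 + 8 * (p + q) + (p + q) * (p + q)
  expand-cycle p q = trans (square (2 + p + (2 + q))) (solve (p ∷ q ∷ []))

  expand-pendant : ∀ p → (2 + p + 1) ^ 2 ≡ (3 + p) * (3 + p)
  expand-pendant p = trans (square (2 + p + 1)) (solve (p ∷ []))

  cycle-part : ∑ w C ≡ 16 * suc n + 16 * total PL + ∑ (λ e → x e * x e) C
  cycle-part = begin
    ∑ w C
      ≡⟨ ∑-cong C (λ {(a , b)} e∈ → cong₂ (λ y z → (y + z) ^ 2)
           (deg-unicyclic-cycle PL (proj₁ (cycleEdge-endpoints e∈)))
           (deg-unicyclic-cycle PL (proj₂ (cycleEdge-endpoints e∈)))) ⟩
    ∑ (λ (a , b) → (2 + L a + (2 + L b)) ^ 2) C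
      ≡⟨ ∑-cong C (λ {(a , b)} _ → expand-cycle (L a) (L b)) ⟩
    ∑ (λ e → 16 + 8 * x e + x e * x e) C
      ≡⟨ ∑-+ (λ e → 16 + 8 * x e) (λ e → x e * x e) C ⟩
    ∑ (λ e → 16 + 8 * x e) C + ∑ (λ e → x e * x e) C
      ≡⟨ cong (_+ ∑ (λ e → x e * x e) C) (∑-+ (λ _ → 16) (λ e → 8 * x e) C) ⟩
    ∑ (λ _ → 16) C + ∑ (λ e → 8 * x e) C + ∑ (λ e → x e * x e) C
      ≡⟨ cong₂ (λ y z → y + z + ∑ (λ e → x e * x e) C)
           (trans (∑-const 16 C) (trans (cong (_* 16) (length-cycleEdges n)) (*-comm (suc n) 16)))
           (trans (∑-*ˡ 8 x C) (trans (cong (8 *_) (∑-edgeLoad-cycleEdges PL roots)) (sym (*-assoc 8 2 (total PL))))) ⟩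
    16 * suc n + 16 * total PL + ∑ (λ e → x e * x e) C  ∎

  pendant-part : ∑ w P ≡ ∑ (λ (u , l) → l * ((3 + L u) * (3 + L u))) PL
  pendant-part = begin
    ∑ w P
      ≡⟨ ∑-pendantEdges w (λ u → (D u + 1) ^ 2) (suc n) PL
           (λ {u} t< → cong (λ y → (D u + y) ^ 2) (deg-unicyclic-pendant PL roots t<)) ⟩
    ∑ (λ (u , l) → l * (D u + 1) ^ 2) PL
      ≡⟨ ∑-cong PL (λ {(u , l)} p∈ → cong (λ d → l * (d + 1) ^ 2) (deg-unicyclic-cycle PL (roots p∈))) ⟩
    ∑ (λ (u , l) → l * (2 + L u + 1) ^ 2) PL
      ≡⟨ ∑-cong PL (λ {(u , l)} _ → cong (l *_) (expand-pendant (L u))) ⟩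
    ∑ (λ (u , l) → l * ((3 + L u) * (3 + L u))) PL  ∎

-- Comparison with C_m(n − m)

load+load-≤ : ∀ PL {a b} → a ≢ b → load PL a + load PL b ≤ total PL
load+load-≤ PL {a} {b} a≢b = begin
  load PL a + load PL b                          ≡⟨ sym (∑-+ (λ (u , l) → l * δ u a) (λ (u , l) → l * δ u b) PL) ⟩
  ∑ (λ (u , l) → l * δ u a + l * δ u b) PL       ≡⟨ ∑-cong PL (λ {(u , l)} _ → sym (*-distribˡ-+ l (δ u a) (δ u b))) ⟩
  ∑ (λ (u , l) → l * (δ u a + δ u b)) PL         ≤⟨ ∑-mono-≤ PL (λ {(u , l)} _ → *-monoʳ-≤ l (δ+δ≤1 u a≢b)) ⟩
  ∑ (λ (u , l) → l * 1) PL                       ≡⟨ ∑-cong PL (λ {(u , l)} _ → *-identityʳ l) ⟩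
  total PL                                       ∎
  where open ≤-Reasoning

∑-square-≤ : ∀ {A : Set} (f : A → ℕ) c xs → (∀ {x} → x ∈ xs → f x ≤ c) →
  ∑ (λ x → f x * f x) xs ≤ c * ∑ f xs
∑-square-≤ f c xs f≤c = begin
  ∑ (λ x → f x * f x) xs  ≤⟨ ∑-mono-≤ xs (λ {x} x∈ → *-monoˡ-≤ (f x) (f≤c x∈)) ⟩
  ∑ (λ x → c * f x) xs    ≡⟨ ∑-*ˡ c f xs ⟩
  c * ∑ f xs              ∎
  where open ≤-Reasoning

cycleSquares-≤ : ∀ n PL → RootsBelow (2 + n) PL →
  ∑ (λ e → edgeLoad (load PL) e * edgeLoad (load PL) e) (cycleEdges (2 + n)) ≤ total PL * (2 * total PL)
cycleSquares-≤ n PL roots = begin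
  ∑ (λ e → edgeLoad (load PL) e * edgeLoad (load PL) e) (cycleEdges (2 + n))
    ≤⟨ ∑-square-≤ (edgeLoad (load PL)) (total PL) (cycleEdges (2 + n))
         (λ {(a , b)} e∈ → load+load-≤ PL (cycleEdge-loopless e∈)) ⟩
  total PL * ∑ (edgeLoad (load PL)) (cycleEdges (2 + n))
    ≡⟨ cong (total PL *_) (∑-edgeLoad-cycleEdges PL roots) ⟩
  total PL * (2 * total PL)  ∎
  where open ≤-Reasoning

single-rootsBelow : ∀ {s c} p → c < s → RootsBelow s ((c , p) ∷ [])
single-rootsBelow p c<s (here refl) = c<s

multiple-of-bit-square : ∀ p {y} → y ≤ 1 → (p * y) * (p * y) ≡ p * (p * y)
multiple-of-bit-square p {0} _ = solve (p ∷ [])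
multiple-of-bit-square p {1} _ = solve (p ∷ [])
multiple-of-bit-square p {suc (suc _)} (s≤s ())

cycleSquares-single : ∀ n c p → c < 2 + n →
  ∑ (λ e → edgeLoad (load ((c , p) ∷ [])) e * edgeLoad (load ((c , p) ∷ [])) e) (cycleEdges (2 + n)) ≡ p * (2 * p)
cycleSquares-single n c p c<m = begin
  ∑ (λ e → x e * x e) (cycleEdges (2 + n))  ≡⟨ ∑-cong (cycleEdges (2 + n)) (λ {(a , b)} e∈ → edge-square e∈) ⟩
  ∑ (λ e → p * x e) (cycleEdges (2 + n))    ≡⟨ ∑-*ˡ p x (cycleEdges (2 + n)) ⟩
  p * ∑ x (cycleEdges (2 + n))              ≡⟨ cong (p *_) (∑-edgeLoad-cycleEdges ((c , p) ∷ []) (single-rootsBelow p c<m)) ⟩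
  p * (2 * (p + 0))                         ≡⟨ cong (λ q → p * (2 * q)) (+-identityʳ p) ⟩
  p * (2 * p)                               ∎
  where
  open ≡-Reasoning
  x = edgeLoad (load ((c , p) ∷ []))
  x≡ : ∀ a b → x (a , b) ≡ p * (δ c a + δ c b)
  x≡ a b = factor p (δ c a) (δ c b)
    where
    factor : ∀ p y z → p * y + 0 + (p * z + 0) ≡ p * (y + z)
    factor = solve-∀
  edge-square : ∀ {a b} → (a , b) ∈ cycleEdges (2 + n) → x (a , b) * x (a , b) ≡ p * x (a , b)
  edge-square {a} {b} e∈ rewrite x≡ a b = multiple-of-bit-square p (δ+δ≤1 c (cycleEdge-loopless e∈))

pendantHM : ℕ → ℕ
pendantHM p = p * ((3 + p) * (3 + p))

pendantHM-+ : ∀ a b → pendantHM (a + b) ≡ pendantHM a + pendantHM b + 3 * a * b * (4 + a + b)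
pendantHM-+ = polynomial-identity
  where
  polynomial-identity : ∀ a b → (a + b) * ((3 + (a + b)) * (3 + (a + b)))
    ≡ a * ((3 + a) * (3 + a)) + b * ((3 + b) * (3 + b)) + 3 * a * b * (4 + a + b)
  polynomial-identity = solve-∀

pendantHM-superadditive : ∀ a b → pendantHM a + pendantHM b ≤ pendantHM (a + b)
pendantHM-superadditive a b = ≤-trans (m≤m+n _ _) (≤-reflexive (sym (pendantHM-+ a b)))

pendantHM-strictly-superadditive : ∀ {a b} → 1 ≤ a → 1 ≤ b → pendantHM a + pendantHM b < pendantHM (a + b)
pendantHM-strictly-superadditive {suc a} {suc b} _ _ =
  <-≤-trans (m<m+n _ (s≤s z≤n)) (≤-reflexive (sym (pendantHM-+ (suc a) (suc b))))

∑-pendantHM-≤ : ∀ xs → ∑ pendantHM xs ≤ pendantHM (sum xs)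
∑-pendantHM-≤ [] = z≤n
∑-pendantHM-≤ (x ∷ xs) = ≤-trans (+-monoʳ-≤ (pendantHM x) (∑-pendantHM-≤ xs)) (pendantHM-superadditive x (sum xs))

∑-pendantHM-< : ∀ x y zs → 1 ≤ x → 1 ≤ y → ∑ pendantHM (x ∷ y ∷ zs) < pendantHM (sum (x ∷ y ∷ zs))
∑-pendantHM-< x y zs 1≤x 1≤y = begin-strict
  pendantHM x + ∑ pendantHM (y ∷ zs)     ≤⟨ +-monoʳ-≤ (pendantHM x) (∑-pendantHM-≤ (y ∷ zs)) ⟩
  pendantHM x + pendantHM (y + sum zs)   <⟨ pendantHM-strictly-superadditive 1≤x (≤-trans 1≤y (m≤m+n y (sum zs))) ⟩
  pendantHM (x + (y + sum zs))           ∎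
  where open ≤-Reasoning

starHM : ℕ → ℕ → ℕ
starHM m p = 16 * m + 16 * p + p * (2 * p) + pendantHM p

load-single-root : ∀ c p → load ((c , p) ∷ []) c ≡ p
load-single-root c p rewrite δ-refl c = trans (+-identityʳ (p * 1)) (*-identityʳ p)

HM-unicyclic-single : ∀ n c p → c < 2 + n → HM (unicyclic (2 + n) ((c , p) ∷ [])) ≡ starHM (2 + n) p
HM-unicyclic-single n c p c<m = begin
  HM (unicyclic (2 + n) PL)
    ≡⟨ HM-unicyclic (suc n) PL (single-rootsBelow p c<m) ⟩
  16 * (2 + n) + 16 * (p + 0) + ∑ (λ e → x e * x e) (cycleEdges (2 + n)) + (p * ((3 + L c) * (3 + L c)) + 0)
    ≡⟨ cong₂ (λ q r → 16 * (2 + n) + 16 * q + r + (p * ((3 + L c) * (3 + L c)) + 0))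
             (+-identityʳ p) (cycleSquares-single n c p c<m) ⟩
  16 * (2 + n) + 16 * p + p * (2 * p) + (p * ((3 + L c) * (3 + L c)) + 0)
    ≡⟨ cong (λ q → 16 * (2 + n) + 16 * p + p * (2 * p) + (p * ((3 + q) * (3 + q)) + 0)) (load-single-root c p) ⟩
  16 * (2 + n) + 16 * p + p * (2 * p) + (pendantHM p + 0)
    ≡⟨ cong (16 * (2 + n) + 16 * p + p * (2 * p) +_) (+-identityʳ (pendantHM p)) ⟩
  starHM (2 + n) p  ∎
  where
  open ≡-Reasoning
  PL = (c , p) ∷ []
  L = load PL
  x = edgeLoad L

pendants : ∀ {m k} → (Fin k → Fin m) → (Fin k → ℕ) → List (ℕ × ℕ)
pendants u l = tabulate (λ i → (toℕ (u i) , l i))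

module _ {m k : ℕ} (u : Fin k → Fin m) (l : Fin k → ℕ) where

  pendants-rootsBelow : RootsBelow m (pendants u l)
  pendants-rootsBelow p∈ with i , refl ← ∈-tabulate⁻ p∈ = toℕ<n (u i)

  total-pendants : total (pendants u l) ≡ sum (tabulate l)
  total-pendants = cong sum (map-tabulate (λ i → (toℕ (u i) , l i)) proj₂)

load-pendants : ∀ {m k} (u : Fin k → Fin m) l → Injective _≡_ _≡_ u →
  ∀ i → load (pendants u l) (toℕ (u i)) ≡ l i
load-pendants u l u-inj fzero = begin
  l fzero * δ (toℕ (u fzero)) (toℕ (u fzero)) + load (pendants (u ∘ fsuc) (l ∘ fsuc)) (toℕ (u fzero))
    ≡⟨ cong₂ _+_ (cong (l fzero *_) (δ-refl (toℕ (u fzero)))) (load-absent (pendants (u ∘ fsuc) (l ∘ fsuc)) absent) ⟩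
  l fzero * 1 + 0
    ≡⟨ trans (+-identityʳ (l fzero * 1)) (*-identityʳ (l fzero)) ⟩
  l fzero  ∎
  where
  open ≡-Reasoning
  absent : ∀ {p} → p ∈ pendants (u ∘ fsuc) (l ∘ fsuc) → proj₁ p ≢ toℕ (u fzero)
  absent p∈ with j , refl ← ∈-tabulate⁻ p∈ = λ eq → fzero≢fsuc (u-inj (toℕ-injective (sym eq)))
load-pendants u l u-inj (fsuc i) = cong₂ _+_
  (trans (cong (l fzero *_) (δ-≢ (λ eq → fzero≢fsuc (u-inj (toℕ-injective eq))))) (*-zeroʳ (l fzero)))
  (load-pendants (u ∘ fsuc) (l ∘ fsuc) (fsuc-injective ∘ u-inj) i)

pendantSquares-pendants : ∀ {m k} (u : Fin k → Fin m) l → Injective _≡_ _≡_ u →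
  ∑ (λ (v , n) → n * ((3 + load (pendants u l) v) * (3 + load (pendants u l) v))) (pendants u l)
    ≡ ∑ pendantHM (tabulate l)
pendantSquares-pendants u l u-inj = begin
  ∑ g (tabulate (λ i → (toℕ (u i) , l i)))   ≡⟨ cong sum (map-tabulate (λ i → (toℕ (u i) , l i)) g) ⟩
  sum (tabulate (λ i → g (toℕ (u i) , l i)))
    ≡⟨ cong sum (tabulate-cong (λ i → cong (λ q → l i * ((3 + q) * (3 + q))) (load-pendants u l u-inj i))) ⟩
  sum (tabulate (pendantHM ∘ l))             ≡⟨ cong sum (sym (map-tabulate l pendantHM)) ⟩
  ∑ pendantHM (tabulate l)                   ∎
  where
  open ≡-Reasoning
  g : ℕ × ℕ → ℕ
  g (v , n) = n * ((3 + load (pendants u l) v) * (3 + load (pendants u l) v))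

HM-Cml-≤-cycleBound : ∀ {n k} (u : Fin k → Fin (2 + n)) l → Injective _≡_ _≡_ u →
  HM (Cml (2 + n) k u l) ≤ 16 * (2 + n) + 16 * sum (tabulate l) + sum (tabulate l) * (2 * sum (tabulate l))
                           + ∑ pendantHM (tabulate l)
HM-Cml-≤-cycleBound {n} u l u-inj = begin
  HM (Cml (2 + n) _ u l)
    ≡⟨ HM-unicyclic (suc n) PL (pendants-rootsBelow u l) ⟩
  16 * (2 + n) + 16 * total PL + ∑ (λ e → edgeLoad (load PL) e * edgeLoad (load PL) e) (cycleEdges (2 + n))
    + ∑ (λ (v , n) → n * ((3 + load PL v) * (3 + load PL v))) PL
    ≤⟨ +-mono-≤ (+-monoʳ-≤ (16 * (2 + n) + 16 * total PL) (cycleSquares-≤ n PL (pendants-rootsBelow u l)))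
                (≤-reflexive (pendantSquares-pendants u l u-inj)) ⟩
  16 * (2 + n) + 16 * total PL + total PL * (2 * total PL) + ∑ pendantHM (tabulate l)
    ≡⟨ cong (λ S → 16 * (2 + n) + 16 * S + S * (2 * S) + ∑ pendantHM (tabulate l)) (total-pendants u l) ⟩
  16 * (2 + n) + 16 * sum (tabulate l) + sum (tabulate l) * (2 * sum (tabulate l)) + ∑ pendantHM (tabulate l)  ∎
  where
  open ≤-Reasoning
  PL = pendants u l

HM-Cml-< : ∀ {n k} (u : Fin (2 + k) → Fin (2 + n)) l → Injective _≡_ _≡_ u → (∀ i → 1 ≤ l i) →
  HM (Cml (2 + n) (2 + k) u l) < starHM (2 + n) (sum (tabulate l))
HM-Cml-< u l u-inj l≥1 = ≤-<-trans (HM-Cml-≤-cycleBound u l u-inj)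
  (+-monoʳ-< _ (∑-pendantHM-< (l fzero) (l (fsuc fzero)) (tabulate (l ∘ fsuc ∘ fsuc))
                                (l≥1 fzero) (l≥1 (fsuc fzero))))

HM-Cm1-order : ∀ n k l → HM (Cm1 (2 + n) (order (2 + n) k l ∸ (2 + n))) ≡ starHM (2 + n) (sum (tabulate l))
HM-Cm1-order n k l = trans (HM-unicyclic-single n 0 _ z<s)
  (cong (starHM (2 + n)) (m+n∸m≡n (2 + n) (sum (tabulate l))))

lemma2p7 : (m k : ℕ) → 3 ≤ m → 1 ≤ k →
    (u : Fin k → Fin m) → Injective _≡_ _≡_ u →
    (l : Fin k → ℕ) → (∀ i → 1 ≤ l i) →
    (HM (Cml m k u l) ≤ HM (Cm1 m (order m k l ∸ m)))
    × ((HM (Cml m k u l) ≡ HM (Cm1 m (order m k l ∸ m))) ⇔ (k ≡ 1))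
lemma2p7 (suc (suc n)) 1 (s≤s (s≤s _)) _ u _ l _ = ≤-reflexive single , mk⇔ (λ _ → refl) (λ _ → single)
  where
  single : HM (Cml (2 + n) 1 u l) ≡ HM (Cm1 (2 + n) (order (2 + n) 1 l ∸ (2 + n)))
  single = trans (HM-unicyclic-single n (toℕ (u fzero)) (l fzero) (toℕ<n (u fzero)))
    (sym (trans (HM-Cm1-order n 1 l) (cong (starHM (2 + n)) (+-identityʳ (l fzero)))))
lemma2p7 (suc (suc n)) (suc (suc k)) (s≤s (s≤s _)) _ u u-inj l l≥1 =
  <⇒≤ strict , mk⇔ (λ eq → ⊥-elim (<-irrefl eq strict)) (λ ())
  where
  strict : HM (Cml (2 + n) (2 + k) u l) < HM (Cm1 (2 + n) (order (2 + n) (2 + k) l ∸ (2 + n)))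
  strict = subst (HM (Cml (2 + n) (2 + k) u l) <_) (sym (HM-Cm1-order n (2 + k) l)) (HM-Cml-< u l u-inj l≥1)
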